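{- Let $(\Phi,\mathfrak N,\mathfrak T,\mathfrak R,\mathfrak S,\phi_{\mathrm{start}},\Sigma,\mathrm{Lex},\mathrm{Sel})$ be a parameterized local lexing, $D\in\Sigma^*$, $0\le k\le|D|$, $T$ a set of parameterized tokens, $I$ a set of parameterized items and $I'$ a set of ordinary items of the induced grammar. If $I\sim I'$, then $\mathcal U(\mathrm{Tokens}\,T\,k\,I)=\mathrm{Tokens}'\,\mathcal U(T)\,k\,I'$.
   Context: $\Phi$ is a non-empty set; $\mathfrak N,\mathfrak T$ disjoint sets of nonterminals and terminals; $\mathfrak S\in\mathfrak N$, $\phi_{\mathrm{start}}\in\Phi$; $\mathfrak R$ a set of parameterized rules $N_{f_{k+1}}\to X_1^{f_1}\cdots X_k^{f_k}$ ($k\ge0$, $N\in\mathfrak N$, $X_i\in\mathfrak N\cup\mathfrak T$, partial $f_i:\Phi^{2i-1}\rightharpoonup\Phi$); $\Sigma$ a set of characters; $\mathrm{Lex}$ assigns to each $(t,\alpha,D,k)$ ($t\in\mathfrak T,\alpha\in\Phi,D\in\Sigma^*,0\le k\le|D|$) a set of parameterized tokens $(t,\alpha,\beta,c)\in\mathfrak T\times\Phi\times\Phi\times\Sigma^*$ with $k+|c|\le|D|$, $c_i=D_{k+i}$ for $0\le i<|c|$; $\mathrm{Sel}$ maps pairs $(A,B)$ of sets of parameterized tokens to a set, with $A\subseteq\mathrm{Sel}(A,B)\subseteq B$ whenever $A\subseteq B$. Sequences indexed from 0; $\mathrm{take}_n$ takes the first $n$ entries. $\langle f_1,\dots,f_u\rangle$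 is the set of $\rho\in\Phi^{2u}$ with $f_i$ defined at $(\rho_0,\dots,\rho_{2i-2})$ and $\rho_{2i-1}=f_i(\rho_0,\dots,\rho_{2i-2})$ for $i=1,\dots,u$. Induced grammar: nonterminals $(\mathfrak N\times\Phi\times\Phi)\cup\{\top,\bot\}$, terminals $\overline{\mathfrak T}=\mathfrak T\times\Phi\times\Phi$, triples written $X^\alpha_\beta$; rules $\overline{\mathfrak R}=\{\top\to\mathfrak S^{\phi_{\mathrm{start}}}_\beta\mid\beta\in\Phi\}\cup\bigcup_{r\in\mathfrak R}\overline r$, where for $r=N_{f_{k+1}}\to X_1^{f_1}\cdots X_k^{f_k}$, $\overline r$ consists of (i) rules $N^\alpha_\beta\to(X_1)^{\alpha_1}_{\beta_1}\cdots(X_k)^{\alpha_k}_{\beta_k}$ with $(\alpha,\alpha_1,\beta_1,\dots,\alpha_k,\beta_k,\beta)\in\langle f_1,\dots,f_{k+1}\rangle$, and (ii) rules $N^\alpha_\beta\to(X_1)^{\alpha_1}_{\beta_1}\cdots(X_h)^{\alpha_h}_{\beta_h}\bot$ with $1\le h\le k$, $\beta,\beta_h\in\Phi$, $(\alpha,\alpha_1,\beta_1,\dots,\alpha_h)\in\langle f_1,\dots,f_h\rangle$ and $f_{h+1}$ undefined at $(\alpha,\alpha_1,\beta_1,\dots,\alpha_h,\beta_h)$. Induced lexer $\overline{\mathrm{Lex}}(t^\alpha_\beta)(D,k)=\{(t^\alpha_\beta,c)\mid(t,\alpha,\beta,c)\in\mathrm{Lex}(t,\alpha,D,k)\}$.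 $\mathcal U(t,\alpha,\beta,c)=(t^\alpha_\beta,c)$ is a bijection onto $\overline{\mathfrak T}\times\Sigma^*$, lifted to sets; induced selector $\overline{\mathrm{Sel}}(A,B)=\mathcal U(\mathrm{Sel}(\mathcal U^{ -1}A,\mathcal U^{ -1}B))$. Items: parameterized item $(r,d,i,j,\rho)$ with $r=N_{f_{v+1}}\to X_1^{f_1}\cdots X_v^{f_v}\in\mathfrak R$, $0\le d\le v$, $0\le i\le j\le|D|$, $\rho\in\langle f_1,\dots,f_{d+1}\rangle$. Ordinary item $(q,d,i,j)$ with $q=(L\to w)\in\overline{\mathfrak R}$, $0\le d\le|w|$, $0\le i\le j\le|D|$, written $(L\to w_1\bullet w_2,i,j)$, $|w_1|=d$. For $x=(r,d,i,j,\rho)$, $\overline x$ consists of all $(q,d,i,j)$ with $q\in\overline r$ of type (i) and $\mathrm{take}_{2(d+1)}(\alpha,\alpha_1,\beta_1,\dots,\alpha_k,\beta_k,\beta)=\rho$, and all $(q,d,i,j)$ with $q\in\overline r$ of type (ii), $d\le h-1$, $\mathrm{take}_{2(d+1)}(\alpha,\alpha_1,\beta_1,\dots,\alpha_h)=\rho$. $\overline I=\bigcup_{x\in I}\overline x$; $\mathrm{Norm}(I')=\{(L\to w_1\bullet w_2,i,j)\in I'\mid L\ne\top,\ w_2\text{ is not the one-symbol string }\bot\}$; $I\sim I'$ means $\overline I=\mathrm{Norm}(I')$. $\mathrm{Tokens}\,T\,k\,I=\mathrm{Sel}(T,V)$ with $V=\{x\mid(r,d,i,k,\rho)\in I,\ r=N_{f_{v+1}}\to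 X_1^{f_1}\cdots X_v^{f_v},\ d<v,\ X_{d+1}\in\mathfrak T,\ x\in\mathrm{Lex}(X_{d+1},\rho_{2d+1},D,k)\}$. $\mathrm{Tokens}'\,T'\,k\,I'=\overline{\mathrm{Sel}}(T',V')$ with $V'=\{x\mid(L\to a\bullet t\,b,i,k)\in I',\ t\in\overline{\mathfrak T},\ x\in\overline{\mathrm{Lex}}(t)(D,k)\}$. -}

module Defs where

open import Data.Nat using (ℕ; zero; suc; _+_; _*_; _∸_; _≤_; _<_)
open import Data.List using (List; []; _∷_; _++_; length; take; drop; head)
open import Data.Maybe using (Maybe; just; nothing)
open import Data.Product using (Σ; ∃; ∃-syntax; _×_; _,_)
open import Data.Sum using (_⊎_; inj₁; inj₂)
open import Relation.Binary.PropositionalEquality using (_≡_; _≢_)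
open import Relation.Unary using (Pred; _⊆_; _≐_)
open import Level using (0ℓ)

-- Parameterized rules  N_{f_{k+1}} → X_1^{f_1} ⋯ X_k^{f_k}
-- Symbols X ∈ 𝔑 ∪ 𝔗 are encoded as 𝔑 ⊎ 𝔗 (this makes 𝔑, 𝔗 disjoint).
-- A partial function f_i : Φ^{2i-1} ⇀ Φ is encoded as
--   fn i : List Φ → Maybe Φ   (1-based i, nothing = undefined);
-- only the values fn i xs with 1 ≤ i ≤ k+1 and length xs = 2i-1 are
-- ever used; all other values are irrelevant junk.

record PRule (Φ N T : Set) : Set where
  constructor prule
  field
    lhs : N
    rhs : List (N ⊎ T)
    fn  : ℕ → List Φ → Maybe Φ

-- ρ ∈ ⟨f_1,…,f_u⟩ : ρ ∈ Φ^{2u} and for i = 1..u,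
-- f_i is defined at (ρ_0,…,ρ_{2i-2}) with value ρ_{2i-1}.

Angle : {Φ : Set} → (ℕ → List Φ → Maybe Φ) → ℕ → List Φ → Set
Angle f u ρ =
  length ρ ≡ 2 * u ×
  (∀ i → 1 ≤ i → i ≤ u → f i (take (2 * i ∸ 1) ρ) ≡ head (drop (2 * i ∸ 1) ρ))

record PLL : Set₁ where
  field
    Φ      : Set
    𝔑      : Set
    𝔗      : Set
    𝔖      : 𝔑
    φstart : Φ
    ℜ      : PRule Φ 𝔑 𝔗 → Set
    Chr    : Set
  PTok : Set
  PTok = 𝔗 × Φ × Φ × List Chr
  field
    Lex    : 𝔗 → Φ → List Chr → ℕ → Pred PTok 0ℓ
    Lex-ok : ∀ t α D k → k ≤ length D → ∀ t' α' β c → Lex t α D k (t' , α' , β , c) →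
             t' ≡ t × α' ≡ α × k + length c ≤ length D × c ≡ take (length c) (drop k D)
    Sel    : Pred PTok 0ℓ → Pred PTok 0ℓ → Pred PTok 0ℓ
    Sel-ok : ∀ A B → A ⊆ B → (A ⊆ Sel A B) × (Sel A B ⊆ B)
    -- Sel is a function of *sets*, so it respects extensional equality
    Sel-ext : ∀ {A A' B B'} → A ≐ A' → B ≐ B' → Sel A B ≐ Sel A' B'

image : {A B : Set} → (A → B) → Pred A 0ℓ → Pred B 0ℓ
image f S y = ∃[ x ] (S x × f x ≡ y)

preimage : {A B : Set} → (A → B) → Pred B 0ℓ → Pred A 0ℓ
preimage f S x = S (f x)

module Induced (L : PLL) where
  open PLL L public

  data NTbar : Set where
    ⊤̂ : NTbar
    ⊥̂ : NTbar
    nt : 𝔑 → Φ → Φ → NTbar          -- nt N α β  =  N^α_β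

  -- terminals 𝔗 × Φ × Φ   (t , α , β)  =  t^α_β
  Tbar : Set
  Tbar = 𝔗 × Φ × Φ

  SymBar : Set
  SymBar = NTbar ⊎ Tbar

  liftSym : 𝔑 ⊎ 𝔗 → Φ → Φ → SymBar
  liftSym (inj₁ N) α β = inj₁ (nt N α β)
  liftSym (inj₂ t) α β = inj₂ (t , α , β)

  liftSeq : List (𝔑 ⊎ 𝔗) → List Φ → List SymBar
  liftSeq (X ∷ Xs) (a ∷ b ∷ ps) = liftSym X a b ∷ liftSeq Xs ps
  liftSeq _        _            = []

  ORule : Set
  ORule = NTbar × List SymBar

  module _ (r : PRule Φ 𝔑 𝔗) where
    open PRule r

    -- type (i):  N^α_β → (X_1)^{α_1}_{β_1} ⋯ (X_k)^{α_k}_{β_k},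
    -- ps = (α_1,β_1,…,α_k,β_k),  (α,ps,β) ∈ ⟨f_1,…,f_{k+1}⟩
    TypeI : Φ → List Φ → Φ → Set
    TypeI α ps β = length ps ≡ 2 * length rhs × Angle fn (suc (length rhs)) (α ∷ ps ++ β ∷ [])

    ruleI : Φ → List Φ → Φ → ORule
    ruleI α ps β = nt lhs α β , liftSeq rhs ps

    -- type (ii):  N^α_β → (X_1)^{α_1}_{β_1} ⋯ (X_h)^{α_h}_{β_h} ⊥,
    -- ps = (α_1,β_1,…,α_h,β_h), 1 ≤ h ≤ k,
    -- (α,α_1,β_1,…,α_h) ∈ ⟨f_1,…,f_h⟩, f_{h+1} undefined at (α,ps)
    TypeII : ℕ → Φ → List Φ → Φ → Set
    TypeII h α ps β =
      1 ≤ h × h ≤ length rhs × length ps ≡ 2 * h ×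
      Angle fn h (α ∷ take (2 * h ∸ 1) ps) × fn (suc h) (α ∷ ps) ≡ nothing

    ruleII : ℕ → Φ → List Φ → Φ → ORule
    ruleII h α ps β = nt lhs α β , liftSeq (take h rhs) ps ++ inj₁ ⊥̂ ∷ []

  InRbar : ORule → Set
  InRbar q =
    (∃[ β ] q ≡ (⊤̂ , inj₁ (nt 𝔖 φstart β) ∷ [])) ⊎
    (∃[ r ] (ℜ r ×
      ((∃[ α ] ∃[ ps ] ∃[ β ] (TypeI r α ps β × q ≡ ruleI r α ps β)) ⊎
       (∃[ h ] ∃[ α ] ∃[ ps ] ∃[ β ] (TypeII r h α ps β × q ≡ ruleII r h α ps β)))))

  record OItem : Set where
    constructor oitem
    field
      olhs : NTbar
      orhs : List SymBar
      odot : ℕ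
      oi   : ℕ
      oj   : ℕ
  open OItem public

  ValidO : List Chr → OItem → Set
  ValidO D y = InRbar (olhs y , orhs y) × odot y ≤ length (orhs y) ×
               oi y ≤ oj y × oj y ≤ length D

  record PItem : Set where
    constructor pitem
    field
      prl  : PRule Φ 𝔑 𝔗
      pdot : ℕ
      pi   : ℕ
      pj   : ℕ
      pρ   : List Φ
  open PItem public

  ValidP : List Chr → PItem → Set
  ValidP D x = ℜ (prl x) × pdot x ≤ length (PRule.rhs (prl x)) ×
               pi x ≤ pj x × pj x ≤ length D ×
               Angle (PRule.fn (prl x)) (suc (pdot x)) (pρ x)

  InBar : PItem → OItem → Set
  InBar (pitem r d i j ρ) y =
    (∃[ α ] ∃[ ps ] ∃[ β ] (TypeI r α ps β ×
        y ≡ oitem (nt (PRule.lhs r) α β) (liftSeq (PRule.rhs r) ps) d i j ×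
        take (2 * suc d) (α ∷ ps ++ β ∷ []) ≡ ρ)) ⊎
    (∃[ h ] ∃[ α ] ∃[ ps ] ∃[ β ] (TypeII r h α ps β ×
        y ≡ oitem (nt (PRule.lhs r) α β) (liftSeq (take h (PRule.rhs r)) ps ++ inj₁ ⊥̂ ∷ []) d i j ×
        d ≤ h ∸ 1 ×
        take (2 * suc d) (α ∷ take (2 * h ∸ 1) ps) ≡ ρ))

  bar : Pred PItem 0ℓ → Pred OItem 0ℓ
  bar I y = ∃[ x ] (I x × InBar x y)

  Norm : Pred OItem 0ℓ → Pred OItem 0ℓ
  Norm I' y = I' y × olhs y ≢ ⊤̂ × drop (odot y) (orhs y) ≢ inj₁ ⊥̂ ∷ []

  _∼_ : Pred PItem 0ℓ → Pred OItem 0ℓ → Set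
  I ∼ I' = bar I ≐ Norm I'

  𝒰 : PTok → Tbar × List Chr
  𝒰 (t , α , β , c) = (t , α , β) , c

  LexBar : Tbar → List Chr → ℕ → Pred (Tbar × List Chr) 0ℓ
  LexBar (t , α , β) D k x = ∃[ c ] (x ≡ ((t , α , β) , c) × Lex t α D k (t , α , β , c))

  SelBar : Pred (Tbar × List Chr) 0ℓ → Pred (Tbar × List Chr) 0ℓ → Pred (Tbar × List Chr) 0ℓ
  SelBar A B = image 𝒰 (Sel (preimage 𝒰 A) (preimage 𝒰 B))

  TokV : List Chr → ℕ → Pred PItem 0ℓ → Pred PTok 0ℓ
  TokV D k I x = ∃[ p ] (I p × pj p ≡ k ×
    ∃[ t ] ∃[ rest ] ∃[ α ] (drop (pdot p) (PRule.rhs (prl p)) ≡ inj₂ t ∷ rest ×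
       head (drop (2 * pdot p + 1) (pρ p)) ≡ just α ×
       Lex t α D k x))

  Tokens : List Chr → Pred PTok 0ℓ → ℕ → Pred PItem 0ℓ → Pred PTok 0ℓ
  Tokens D T k I = Sel T (TokV D k I)

  TokV' : List Chr → ℕ → Pred OItem 0ℓ → Pred (Tbar × List Chr) 0ℓ
  TokV' D k I' x = ∃[ y ] (I' y × oj y ≡ k ×
    ∃[ t ] ∃[ b ] (drop (odot y) (orhs y) ≡ inj₂ t ∷ b × LexBar t D k x))

  Tokens' : List Chr → Pred (Tbar × List Chr) 0ℓ → ℕ → Pred OItem 0ℓ → Pred (Tbar × List Chr) 0ℓ
  Tokens' D T' k I' = SelBar T' (TokV' D k I')

-- Since 𝒰 is a bijection and Sel only depends on its arguments as sets, it suffices that 𝒰 maps the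
-- lexer candidates of I exactly onto those of I'. Along x ∈ I ↦ x̄ ⊆ I' the dot position, the next
-- terminal t = X_{d+1} and its parameter α = ρ_{2d+1} are preserved, so every candidate of I' comes from
-- one of I. Conversely, for a candidate (t, α, β, c) of x one needs some y ∈ x̄ whose next terminal is
-- t^α_β: choose β_{d+1} = β and keep evaluating f_{d+2}, f_{d+3}, … (the remaining βᵢ are arbitrary)
-- until either some f_{h+1} is undefined, giving a rule of type (ii), or all of them are defined,
-- giving a rule of type (i).
module Submission where

open import Defs
open import Data.Nat using (ℕ; zero; suc; _+_; _*_; _∸_; _≤_; _<_; s≤s; z≤n)
open import Data.Nat.Properties
open import Data.List using (List; []; _∷_; _++_; length; take; drop; head)
open import Data.List.Properties using (length-take; take-take; ++-identityʳ; ++-assoc)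
open import Data.Maybe using (Maybe; just; nothing)
open import Data.Product using (∃-syntax; _×_; _,_; proj₁; proj₂)
open import Data.Sum using (inj₁; inj₂)
open import Function using (_∘_; case_of_)
open import Function.Definitions using (Injective)
open import Relation.Binary.PropositionalEquality
open import Relation.Nullary using (contradiction)
open import Relation.Unary using (Pred; _≐_)
open import Level using (0ℓ)

module _ {A : Set} where

  take-++ˡ : ∀ n (xs ys : List A) → n ≤ length xs → take n (xs ++ ys) ≡ take n xs
  take-++ˡ zero    xs       ys _         = refl
  take-++ˡ (suc n) (x ∷ xs) ys (s≤s n≤) = cong (x ∷_) (take-++ˡ n xs ys n≤)

  take-length-++ : ∀ (xs ys : List A) → take (length xs) (xs ++ ys) ≡ xs
  take-length-++ []       ys = refl
  take-length-++ (x ∷ xs) ys = cong (x ∷_) (take-length-++ xs ys)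

  length-∷ʳ : ∀ (xs : List A) {a} → length (xs ++ a ∷ []) ≡ suc (length xs)
  length-∷ʳ []       = refl
  length-∷ʳ (x ∷ xs) = cong suc (length-∷ʳ xs)

  drop-length-++ : ∀ (xs ys : List A) → drop (length xs) (xs ++ ys) ≡ ys
  drop-length-++ []       ys = refl
  drop-length-++ (x ∷ xs) ys = drop-length-++ xs ys

  take-take-≤ : ∀ {n m} (xs : List A) → n ≤ m → take n (take m xs) ≡ take n xs
  take-take-≤ {n} {m} xs n≤m = trans (take-take n m xs) (cong (λ l → take l xs) (m≤n⇒m⊓n≡m n≤m))

  head-drop-take : ∀ n m (xs : List A) → n < m → head (drop n (take m xs)) ≡ head (drop n xs)
  head-drop-take zero    (suc m) []       _         = refl
  head-drop-take zero    (suc m) (x ∷ xs) _         = refl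
  head-drop-take (suc n) (suc m) []       _         = refl
  head-drop-take (suc n) (suc m) (x ∷ xs) (s≤s n<m) = head-drop-take n m xs n<m

  take-agree : ∀ {n N} {xs ys : List A} → n ≤ N → take N xs ≡ take N ys → take n xs ≡ take n ys
  take-agree {xs = xs} {ys} n≤N eq =
    trans (sym (take-take-≤ xs n≤N)) (trans (cong (take _) eq) (take-take-≤ ys n≤N))

  head-drop-agree : ∀ {n N} {xs ys : List A} → n < N → take N xs ≡ take N ys →
                    head (drop n xs) ≡ head (drop n ys)
  head-drop-agree {n} {N} {xs} {ys} n<N eq =
    trans (sym (head-drop-take n N xs n<N)) (trans (cong (head ∘ drop n) eq) (head-drop-take n N ys n<N))

  drop-++-∷ : ∀ n (xs ys : List A) {y zs} → drop n xs ≡ y ∷ zs → drop n (xs ++ ys) ≡ y ∷ zs ++ ys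
  drop-++-∷ zero    (x ∷ xs) ys refl = refl
  drop-++-∷ (suc n) (x ∷ xs) ys eq   = drop-++-∷ n xs ys eq

  drop-∷ʳ-∷ : ∀ n (xs : List A) {z y zs} → drop n (xs ++ z ∷ []) ≡ y ∷ zs → y ≢ z →
              ∃[ zs' ] drop n xs ≡ y ∷ zs'
  drop-∷ʳ-∷ zero          []       refl y≢z = contradiction refl y≢z
  drop-∷ʳ-∷ zero          (x ∷ xs) refl _   = xs , refl
  drop-∷ʳ-∷ (suc zero)    []       ()
  drop-∷ʳ-∷ (suc (suc n)) []       ()
  drop-∷ʳ-∷ (suc n)       (x ∷ xs) eq   y≢z = drop-∷ʳ-∷ n xs eq y≢z

  drop-∷-< : ∀ n (xs : List A) {y zs} → drop n xs ≡ y ∷ zs → n < length xs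
  drop-∷-< zero    (x ∷ xs) _  = s≤s z≤n
  drop-∷-< (suc n) (x ∷ xs) eq = s≤s (drop-∷-< n xs eq)

  drop-last : ∀ n (xs : List A) {a} → length xs ≡ suc n → head (drop n xs) ≡ just a → drop n xs ≡ a ∷ []
  drop-last zero    (x ∷ [])  refl refl = refl
  drop-last (suc n) (x ∷ xs) len  eq   = drop-last n xs (suc-injective len) eq

  drop-take-∷ : ∀ n m (xs : List A) {y zs} → n < m → drop n xs ≡ y ∷ zs →
                drop n (take m xs) ≡ y ∷ take (m ∸ suc n) zs
  drop-take-∷ zero    (suc m) (x ∷ xs) _         refl = refl
  drop-take-∷ (suc n) (suc m) (x ∷ xs) (s≤s n<m) eq   = drop-take-∷ n m xs n<m eq

  drop-take-∷⁻¹ : ∀ n m (xs : List A) {y zs} → drop n (take m xs) ≡ y ∷ zs → ∃[ zs' ] drop n xs ≡ y ∷ zs'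
  drop-take-∷⁻¹ zero    (suc m) (x ∷ xs) refl = xs , refl
  drop-take-∷⁻¹ (suc n) (suc m) (x ∷ xs) eq   = drop-take-∷⁻¹ n m xs eq

  head-drop-odd : ∀ d {a : A} {xs ρ α} → take (2 * suc d) (a ∷ xs) ≡ ρ → head (drop (2 * d) xs) ≡ just α →
                  head (drop (2 * d + 1) ρ) ≡ just α
  head-drop-odd d {a} {xs} refl xs-α = begin
    head (drop (2 * d + 1) prefix)   ≡⟨ cong (λ l → head (drop l prefix)) (+-comm (2 * d) 1) ⟩
    head (drop (suc (2 * d)) prefix) ≡⟨ head-drop-take (suc (2 * d)) (2 * suc d) (a ∷ xs) 1+2d<2+2d ⟩
    head (drop (2 * d) xs)           ≡⟨ xs-α ⟩
    just _                           ∎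
    where
    open ≡-Reasoning
    prefix : List A
    prefix = take (2 * suc d) (a ∷ xs)
    1+2d<2+2d : suc (2 * d) < 2 * suc d
    1+2d<2+2d = s≤s (≤-reflexive (sym (+-suc d (d + 0))))

module Runs {Φ : Set} (f : ℕ → List Φ → Maybe Φ) where

  Consistent : ℕ → List Φ → Set
  Consistent m σ = ∀ i → 1 ≤ i → i ≤ m → f i (take (2 * i ∸ 1) σ) ≡ head (drop (2 * i ∸ 1) σ)

  -- σ = (α, α₁, β₁, …, αₘ, βₘ), the argument list of f_{m+1}; the βᵢ are unconstrained.
  Run : ℕ → List Φ → Set
  Run m σ = length σ ≡ suc (2 * m) × Consistent m σ

  private
    odd-index-< : ∀ {i m} → 1 ≤ i → i ≤ m → 2 * i ∸ 1 < 2 * m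
    odd-index-< {suc i} _ i≤m = *-monoʳ-≤ 2 i≤m

    2*suc∸1 : ∀ m → 2 * suc m ∸ 1 ≡ suc (2 * m)
    2*suc∸1 m = +-suc m (m + 0)

  consistent-agree : ∀ {m σ σ'} → take (2 * m) σ ≡ take (2 * m) σ' → Consistent m σ → Consistent m σ'
  consistent-agree {m} {σ} {σ'} eq c i 1≤i i≤m = begin
    f i (take j σ')  ≡⟨ cong (f i) (take-agree (<⇒≤ j<2m) eq) ⟨
    f i (take j σ)   ≡⟨ c i 1≤i i≤m ⟩
    head (drop j σ)  ≡⟨ head-drop-agree j<2m eq ⟩
    head (drop j σ') ∎
    where
    open ≡-Reasoning
    j : ℕ
    j = 2 * i ∸ 1
    j<2m : j < 2 * m
    j<2m = odd-index-< 1≤i i≤m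

  consistent-suc : ∀ {m σ} → Consistent m σ →
                   f (suc m) (take (2 * suc m ∸ 1) σ) ≡ head (drop (2 * suc m ∸ 1) σ) →
                   Consistent (suc m) σ
  consistent-suc c last i 1≤i i≤1+m with m≤n⇒m<n∨m≡n i≤1+m
  ... | inj₁ (s≤s i≤m) = c i 1≤i i≤m
  ... | inj₂ refl      = last

  run-angle : ∀ {m σ} → Run m σ → Angle f m (take (2 * m) σ)
  run-angle {m} {σ} (len , c) =
    trans (length-take (2 * m) σ) (m≤n⇒m⊓n≡m (subst (2 * m ≤_) (sym len) (n≤1+n _))) ,
    consistent-agree (sym (take-take-≤ σ ≤-refl)) c

  angle-extend : ∀ {m ρ} b → Angle f m ρ → Run m (ρ ++ b ∷ [])
  angle-extend {m} {ρ} b (len , c) =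
    trans (length-∷ʳ ρ) (cong suc len) ,
    consistent-agree (sym (take-++ˡ (2 * m) ρ _ (≤-reflexive (sym len)))) c

  run-extend : ∀ {m σ a} → Run m σ → f (suc m) σ ≡ just a → Angle f (suc m) (σ ++ a ∷ [])
  run-extend {m} {σ} {a} (len , c) fσ =
    trans (length-∷ʳ σ) (cong suc (trans len (sym (2*suc∸1 m)))) ,
    consistent-suc (consistent-agree (sym (take-++ˡ (2 * m) σ _ 2m≤)) c) last
    where
    open ≡-Reasoning
    2m≤ : 2 * m ≤ length σ
    2m≤ = subst (2 * m ≤_) (sym len) (n≤1+n _)
    last : f (suc m) (take (2 * suc m ∸ 1) (σ ++ a ∷ [])) ≡ head (drop (2 * suc m ∸ 1) (σ ++ a ∷ []))
    last rewrite trans (2*suc∸1 m) (sym len) = begin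
      f (suc m) (take (length σ) (σ ++ a ∷ [])) ≡⟨ cong (f (suc m)) (take-length-++ σ _) ⟩
      f (suc m) σ                               ≡⟨ fσ ⟩
      just a                                    ≡⟨ cong head (drop-length-++ σ _) ⟨
      head (drop (length σ) (σ ++ a ∷ []))      ∎

  run-step : ∀ {m σ a} b → Run m σ → f (suc m) σ ≡ just a → Run (suc m) (σ ++ a ∷ b ∷ [])
  run-step {σ = σ} b run fσ = subst (Run _) (++-assoc σ _ _) (angle-extend b (run-extend run fσ))

  -- Iterating f_{m+1}, f_{m+2}, … either reaches a defined f_{K+1} or stops at an undefined f_{h+1};
  -- these are the rules of type (i) and (ii) of the induced grammar.
  data Completion (m K : ℕ) (σ : List Φ) : Set where
    defined   : ∀ τ {β} → Run K (σ ++ τ) → f (suc K) (σ ++ τ) ≡ just β → Completion m K σ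
    undefined : ∀ τ {h} → m ≤ h → h ≤ K → Run h (σ ++ τ) → f (suc h) (σ ++ τ) ≡ nothing →
                Completion m K σ

  weaken : ∀ {m' m K σ} → m' ≤ m → Completion m K σ → Completion m' K σ
  weaken _     (defined τ run fσ)             = defined τ run fσ
  weaken m'≤m (undefined τ m≤h h≤K run fσ) = undefined τ (≤-trans m'≤m m≤h) h≤K run fσ

  private
    complete-from : ∀ n {m K} σ τ (b : Φ) → n + m ≡ K → Run m (σ ++ τ) → Completion m K σ
    complete-from n {m} σ τ b n+m≡K run with f (suc m) (σ ++ τ) in fσ
    ... | nothing = undefined τ ≤-refl (subst (m ≤_) n+m≡K (m≤n+m m n)) run fσ
    complete-from zero    σ τ b refl run | just β = defined τ run fσ
    complete-from (suc n) {m} σ τ b n+m≡K run | just β =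
      weaken (n≤1+n m) (complete-from n σ (τ ++ β ∷ b ∷ []) b (trans (+-suc n m) n+m≡K) run')
      where
      run' : Run (suc m) (σ ++ τ ++ β ∷ b ∷ [])
      run' = subst (Run (suc m)) (++-assoc σ τ _) (run-step b run fσ)

  -- b is the value chosen for every unconstrained βᵢ.
  complete : ∀ {m K} σ (b : Φ) → m ≤ K → Run m σ → Completion m K σ
  complete {m} {K} σ b m≤K run =
    complete-from (K ∸ m) σ [] b (m∸n+n≡m m≤K) (subst (Run m) (sym (++-identityʳ σ)) run)

image-cong : ∀ {A B : Set} (f : A → B) {S S' : Pred A 0ℓ} → S ≐ S' → image f S ≐ image f S'
image-cong f (S⊆S' , S'⊆S) =
  (λ (x , Sx , fx≡y) → x , S⊆S' Sx , fx≡y) , (λ (x , S'x , fx≡y) → x , S'⊆S S'x , fx≡y)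

preimage-image : ∀ {A B : Set} {f : A → B} → Injective _≡_ _≡_ f → (S : Pred A 0ℓ) →
                 S ≐ preimage f (image f S)
preimage-image f-inj S =
  (λ {x} Sx → x , Sx , refl) , (λ (x' , Sx' , fx'≡fx) → subst S (f-inj fx'≡fx) Sx')

module _ (L : PLL) where
  open Induced L

  𝒰-injective : Injective _≡_ _≡_ 𝒰
  𝒰-injective {t , α , β , c} refl = refl

  drop-liftSeq : ∀ n Xs ps {X Xs' a b ps'} → drop n Xs ≡ X ∷ Xs' → drop (2 * n) ps ≡ a ∷ b ∷ ps' →
                 drop n (liftSeq Xs ps) ≡ liftSym X a b ∷ liftSeq Xs' ps'
  drop-liftSeq zero    (X ∷ Xs) (a ∷ b ∷ ps) refl refl = refl
  drop-liftSeq (suc n) (X ∷ Xs) ps           eqX  eqp rewrite *-suc 2 n with ps | eqp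
  ... | a ∷ b ∷ ps' | eqp' = drop-liftSeq n Xs ps' eqX eqp'

  drop-liftSeq⁻¹ : ∀ n Xs ps {t a b w} → drop n (liftSeq Xs ps) ≡ inj₂ (t , a , b) ∷ w →
                   ∃[ Xs' ] ∃[ ps' ] (drop n Xs ≡ inj₂ t ∷ Xs' × drop (2 * n) ps ≡ a ∷ b ∷ ps')
  drop-liftSeq⁻¹ zero    (inj₂ t ∷ Xs) (a ∷ b ∷ ps) refl = Xs , ps , refl , refl
  drop-liftSeq⁻¹ (suc n) (X ∷ Xs)      (p ∷ q ∷ ps) eq with drop-liftSeq⁻¹ n Xs ps eq
  ... | Xs' , ps' , eqX , eqp = Xs' , ps' , eqX , trans (cong (λ l → drop l (p ∷ q ∷ ps)) (*-suc 2 n)) eqp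

  NextTerminal : OItem → Tbar → Set
  NextTerminal y tt = ∃[ w ] drop (odot y) (orhs y) ≡ inj₂ tt ∷ w

  inBar-oj : ∀ x {y} → InBar x y → oj y ≡ pj x
  inBar-oj _ (inj₁ (_ , _ , _ , _ , refl , _))     = refl
  inBar-oj _ (inj₂ (_ , _ , _ , _ , _ , refl , _)) = refl

  module _ (r : PRule Φ 𝔑 𝔗) where
    open PRule r using (lhs; rhs; fn)
    open Runs fn

    ∃-inBar-next-terminal : ∀ {d t Xs α} i j ρ β → Angle fn (suc d) ρ → drop d rhs ≡ inj₂ t ∷ Xs →
                            head (drop (2 * d + 1) ρ) ≡ just α →
                            ∃[ y ] (InBar (pitem r d i j ρ) y × NextTerminal y (t , α , β))
    ∃-inBar-next-terminal {d} {t} {Xs} {α} i j (a ∷ ρ') β ang@(len , _) rhs-d ρ-α =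
      from-completion (complete (a ∷ ρ' ++ β ∷ []) β (drop-∷-< d rhs rhs-d) (angle-extend β ang))
      where
      open ≡-Reasoning

      ps : List Φ → List Φ
      ps τ = (ρ' ++ β ∷ []) ++ τ

      params-length : ∀ {m ps} → Run m (a ∷ ps) → length ps ≡ 2 * m
      params-length (len , _) = suc-injective len

      prefix : ∀ τ → take (2 * suc d) (a ∷ ps τ) ≡ a ∷ ρ'
      prefix τ = begin
        take (2 * suc d) (((a ∷ ρ') ++ β ∷ []) ++ τ)   ≡⟨ cong (take _) (++-assoc (a ∷ ρ') _ τ) ⟩
        take (2 * suc d) ((a ∷ ρ') ++ β ∷ τ)           ≡⟨ cong (λ l → take l ((a ∷ ρ') ++ β ∷ τ)) len ⟨
        take (length (a ∷ ρ')) ((a ∷ ρ') ++ β ∷ τ)     ≡⟨ take-length-++ (a ∷ ρ') _ ⟩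
        a ∷ ρ'                                         ∎

      next : ∀ τ → drop (2 * d) (ps τ) ≡ α ∷ β ∷ τ
      next τ = drop-++-∷ (2 * d) (ρ' ++ β ∷ []) τ
                 (drop-++-∷ (2 * d) ρ' (β ∷ []) (drop-last (2 * d) ρ' ρ'-length ρ'-α))
        where
        ρ'-length : length ρ' ≡ suc (2 * d)
        ρ'-length = trans (suc-injective len) (+-suc d (d + 0))
        ρ'-α : head (drop (2 * d) ρ') ≡ just α
        ρ'-α = subst (λ l → head (drop l (a ∷ ρ')) ≡ just α) (+-comm (2 * d) 1) ρ-α

      from-completion : Completion (suc d) (length rhs) (a ∷ ρ' ++ β ∷ []) →
                        ∃[ y ] (InBar (pitem r d i j (a ∷ ρ')) y × NextTerminal y (t , α , β))
      from-completion (defined τ {β'} run fσ) =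
        oitem (nt lhs a β') (liftSeq rhs (ps τ)) d i j ,
        inj₁ (a , ps τ , β' , (params-length run , run-extend run fσ) , refl ,
              trans (cong (take (2 * suc d)) (++-assoc (a ∷ ρ' ++ β ∷ []) τ _)) (prefix (τ ++ β' ∷ []))) ,
        _ , drop-liftSeq d rhs (ps τ) rhs-d (next τ)
      from-completion (undefined τ {suc h} (s≤s d≤h) h≤K run fσ) =
        oitem (nt lhs a β) (liftSeq (take (suc h) rhs) (ps τ) ++ inj₁ ⊥̂ ∷ []) d i j ,
        inj₂ (suc h , a , ps τ , β , (s≤s z≤n , h≤K , params-length run , run-angle run , fσ) , refl , d≤h ,
              trans (take-take-≤ (a ∷ ps τ) (*-monoʳ-≤ 2 (s≤s d≤h))) (prefix τ)) ,
        _ , drop-++-∷ d _ _ (drop-liftSeq d (take (suc h) rhs) (ps τ)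
                                (drop-take-∷ d (suc h) rhs (s≤s d≤h) rhs-d) (next τ))

  inBar-next-terminal : ∀ x {y t a b w} → InBar x y → drop (odot y) (orhs y) ≡ inj₂ (t , a , b) ∷ w →
                        ∃[ Xs ] (drop (pdot x) (PRule.rhs (prl x)) ≡ inj₂ t ∷ Xs ×
                                 head (drop (2 * pdot x + 1) (pρ x)) ≡ just a)
  inBar-next-terminal (pitem r d i j ρ) (inj₁ (_ , ps , _ , _ , refl , ρ≡)) y-next
    with drop-liftSeq⁻¹ d (PRule.rhs r) ps y-next
  ... | Xs , _ , rhs-d , ps-d = Xs , rhs-d , head-drop-odd d ρ≡ (cong head (drop-++-∷ (2 * d) ps _ ps-d))
  inBar-next-terminal (pitem r d i j ρ) (inj₂ (zero , _ , _ , _ , (() , _) , _))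
  inBar-next-terminal (pitem r d i j ρ) (inj₂ (suc h , _ , ps , _ , _ , refl , d≤h , ρ≡)) y-next
    with drop-∷ʳ-∷ d _ y-next (λ ())
  ... | _ , y-next' with drop-liftSeq⁻¹ d (take (suc h) (PRule.rhs r)) ps y-next'
  ... | _ , _ , rhs-d , ps-d with drop-take-∷⁻¹ d (suc h) (PRule.rhs r) rhs-d
  ... | Xs , rhs-d' =
    Xs , rhs-d' , head-drop-odd d ρ≡ (trans (head-drop-take (2 * d) _ ps 2d<) (cong head ps-d))
    where
    2d< : 2 * d < 2 * suc h ∸ 1
    2d< = ≤-trans (s≤s (*-monoʳ-≤ 2 d≤h)) (≤-reflexive (sym (+-suc h (h + 0))))

  next-terminal-lhs≢⊤ : ∀ y {tt w} → InRbar (olhs y , orhs y) → drop (odot y) (orhs y) ≡ inj₂ tt ∷ w →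
                        olhs y ≢ ⊤̂
  next-terminal-lhs≢⊤ (oitem _ _ zero          _ _) (inj₁ (_ , refl)) ()
  next-terminal-lhs≢⊤ (oitem _ _ (suc zero)    _ _) (inj₁ (_ , refl)) ()
  next-terminal-lhs≢⊤ (oitem _ _ (suc (suc _)) _ _) (inj₁ (_ , refl)) ()
  next-terminal-lhs≢⊤ _ (inj₂ (_ , _ , inj₁ (_ , _ , _ , _ , refl)))     _ ()
  next-terminal-lhs≢⊤ _ (inj₂ (_ , _ , inj₂ (_ , _ , _ , _ , _ , refl))) _ ()

  module _ {D : List Chr} {k : ℕ} (k≤∣D∣ : k ≤ length D) {I : Pred PItem 0ℓ} {I' : Pred OItem 0ℓ}
           (validP : ∀ x → I x → ValidP D x) (validO : ∀ y → I' y → ValidO D y) (I∼I' : I ∼ I') where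

    tokV⊆ : ∀ {x} → TokV D k I x → TokV' D k I' (𝒰 x)
    tokV⊆ {t₀ , α₀ , β , c} (x@(pitem r d i j ρ) , Ix , refl , t , Xs , α , rhs-d , ρ-α , lex)
      with Lex-ok t α D k k≤∣D∣ t₀ α₀ β c lex | validP x Ix
    ... | refl , refl , _ | _ , _ , _ , _ , ang with ∃-inBar-next-terminal r i j ρ β ang rhs-d ρ-α
    ... | y , x∈y , w , y-next =
      y , proj₁ (proj₁ I∼I' (x , Ix , x∈y)) , inBar-oj x x∈y , (t , α , β) , w , y-next , c , refl , lex

    tokV'⊆ : ∀ {x} → TokV' D k I' (𝒰 x) → TokV D k I x
    tokV'⊆ {t , a , b , c} (y , I'y , oj≡k , _ , _ , y-next , _ , refl , lex)
      with proj₂ I∼I' (I'y , next-terminal-lhs≢⊤ y (proj₁ (validO y I'y)) y-next ,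
                         λ y-⊥ → case trans (sym y-next) y-⊥ of λ ())
    ... | x , Ix , x∈y with inBar-next-terminal x x∈y y-next
    ... | Xs , rhs-d , ρ-a = x , Ix , trans (sym (inBar-oj x x∈y)) oj≡k , t , Xs , a , rhs-d , ρ-a , lex

    tokV≐ : TokV D k I ≐ preimage 𝒰 (TokV' D k I')
    tokV≐ = tokV⊆ , tokV'⊆

theorem8 : (L : PLL) → let open Induced L in
    (D : List Chr) (k : ℕ) → k ≤ length D →
    (T : Pred PTok 0ℓ) (I : Pred PItem 0ℓ) (I' : Pred OItem 0ℓ) →
    (∀ x → I x → ValidP D x) → (∀ y → I' y → ValidO D y) →
    I ∼ I' →
    image 𝒰 (Tokens D T k I) ≐ Tokens' D (image 𝒰 T) k I'
theorem8 L D k k≤∣D∣ T I I' validP validO I∼I' =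
  image-cong 𝒰 (Sel-ext (preimage-image (𝒰-injective L) T) (tokV≐ L k≤∣D∣ validP validO I∼I'))
  where open Induced L
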